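{- Let $\mathbf{F}_q$ be a finite field of characteristic $p$, and let $D\subseteq\mathbf{F}_q$ with $|D|=q-1>4$. If $p$ is odd, then for every integer $k$ with $1<k<q-2$ and every $b\in\mathbf{F}_q$ there exist pairwise distinct $x_1,\dots,x_k\in D$ with $x_1+\cdots+x_k=b$. If $p=2$, the same conclusion holds for every integer $k$ with $2<k<q-3$ and every $b\in\mathbf{F}_q$. -}

module Defs where

open import Data.Nat using (ℕ; zero; suc)
open import Data.Nat.Primality using (Prime)
open import Data.Fin using (Fin; zero; suc)
open import Data.Bool using (Bool; T)
open import Data.Product using (Σ; ∃; _×_)
open import Relation.Nullary using (¬_)
open import Relation.Binary.PropositionalEquality using (_≡_)
open import Function.Bundles using (_↔_)
open import Algebra.Core using (Op₁; Op₂)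
open import Algebra.Structures using (IsCommutativeRing)

record FiniteField : Set₁ where
  field
    Carrier : Set
    _+_ _*_ : Op₂ Carrier
    -_      : Op₁ Carrier
    0# 1#   : Carrier
    isCommutativeRing : IsCommutativeRing _≡_ _+_ _*_ -_ 0# 1#
    1≢0     : ¬ (1# ≡ 0#)
    inverse : ∀ x → ¬ (x ≡ 0#) → ∃ λ y → (x * y) ≡ 1#
    q       : ℕ
    enum    : Fin q ↔ Carrier

  infixl 6 _+_
  infixl 7 _*_

  _·1 : ℕ → Carrier
  zero ·1  = 0#
  suc n ·1 = 1# + (n ·1)

  sumFin : (k : ℕ) → (Fin k → Carrier) → Carrier
  sumFin zero    x = 0#
  sumFin (suc k) x = x zero + sumFin k (λ i → x (suc i))

-- The field F has characteristic p (p prime and p · 1 = 0; for a field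
-- this prime is unique, so it is the characteristic).
HasCharacteristic : FiniteField → ℕ → Set
HasCharacteristic F p = Prime p × ((p ·1) ≡ 0#)
  where open FiniteField F

Subset : FiniteField → Set
Subset F = FiniteField.Carrier F → Bool

HasCard : (F : FiniteField) → Subset F → ℕ → Set
HasCard F D n = Fin n ↔ Σ (FiniteField.Carrier F) (λ x → T (D x))

DistinctSumIn : (F : FiniteField) → Subset F → ℕ → FiniteField.Carrier F → Set
DistinctSumIn F D k b =
  ∃ λ (x : Fin k → Carrier) →
    (∀ i j → x i ≡ x j → i ≡ j) × (∀ i → T (D (x i))) × (sumFin k x ≡ b)
  where open FiniteField F

{-# OPTIONS --safe #-}
-- A set D of q − 1 elements is the field with one point a removed. When 2k ≤ q the k summands
-- of b are chosen greedily: each of the first k − 2 avoids a, the remaining target and the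
-- earlier choices (so the new target is nonzero), and the last two are y, c − y with y outside
-- the at most 1 + 2|B| points that would make them collide or hit a forbidden point B. The last
-- step needs the target c to have at most one half z + z = c; this holds for every c when 2 is
-- invertible, but only for c ≠ 0 in characteristic 2, which is why k = 2 is excluded there.
-- When 2k > q the same construction gives q − 1 − k distinct elements of D summing to ΣD − b,
-- and the rest of D sums to b.
module Submission where

open import Defs
open import Data.Nat using (ℕ; zero; suc; _∸_; _<_; _≤_; _≤?_; z≤n; s≤s; s≤s⁻¹)
open import Data.Nat.Properties
  using (≤-refl; ≤-trans; ≤-antisym; <-trans; <⇒≤; <⇒≱; ≰⇒>; n<1+n; 1+n≰n; n≮n; m∸[m∸n]≡n)
open import Data.Nat.DivMod using (_%_; m%n<n)
open import Data.Nat.Divisibility using (m%n≡0⇒n∣m)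
open import Data.Nat.Primality using (Prime; prime⇒irreducible)
open import Data.Fin using (Fin; zero; suc)
import Data.Fin.Properties as Fin
open import Data.Bool using (T)
open import Data.Bool.Properties using (T-irrelevant)
open import Data.Product using (Σ; ∃; _×_; _,_; proj₁; proj₂)
open import Data.Sum using (inj₂)
open import Data.List using (List; []; _∷_; [_]; _++_; length; lookup; map; foldr; tabulate)
open import Data.List.Properties using (length-++; length-map; length-tabulate)
open import Data.List.Relation.Unary.All as All using (All; []; _∷_)
open import Data.List.Relation.Unary.All.Properties using (¬Any⇒All¬)
open import Data.List.Relation.Unary.Any using (here; there; index)
open import Data.List.Relation.Unary.Any.Properties using (lookup-index)
open import Data.List.Relation.Unary.Unique.Propositional using (Unique; []; _∷_)
import Data.List.Relation.Unary.Unique.Propositional.Properties as Unique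
open import Data.List.Membership.Propositional using (_∈_; _∉_)
open import Data.List.Membership.Propositional.Properties
  using (∈-∃++; ∈-++⁺ˡ; ∈-++⁺ʳ; ∈-map⁺; ∈-lookup; ∈-tabulate⁻)
import Data.List.Membership.DecPropositional as DecMembership
open import Data.List.Relation.Binary.Subset.Propositional using (_⊆_)
open import Data.List.Relation.Binary.Permutation.Propositional using (_↭_; ↭-refl; ↭-sym; ↭-trans; ↭-prep; ↭⇒↭ₛ)
open import Data.List.Relation.Binary.Permutation.Propositional.Properties using (shift; ∈-resp-↭; ↭-length)
import Data.List.Relation.Binary.Permutation.Setoid.Properties as PermutationSetoid
open import Function using (_∘_)
open import Function.Bundles using (Inverse; Injection; _↔_)
open import Function.Properties.Inverse using (↔⇒↣; ↔-sym)
open import Relation.Nullary using (Dec; ¬_; yes; no; contradiction)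
open import Relation.Nullary.Decidable using (via-injection)
open import Relation.Binary.PropositionalEquality
  using (_≡_; _≢_; refl; sym; trans; cong; cong₂; subst; setoid; module ≡-Reasoning)
open import Algebra.Core using (Op₁; Op₂)
open import Algebra.Structures using (IsAbelianGroup; IsCommutativeRing)
open import Algebra.Bundles using (AbelianGroup)
import Algebra.Properties.AbelianGroup as AbelianGroupProperties

module _ {A : Set} where

  lookup-injective : ∀ {xs : List A} → Unique xs → ∀ i j → lookup xs i ≡ lookup xs j → i ≡ j
  lookup-injective (_ ∷ _) zero zero _ = refl
  lookup-injective (x≢xs ∷ _) zero (suc j) e = contradiction e (All.lookup x≢xs (∈-lookup j))
  lookup-injective (x≢xs ∷ _) (suc i) zero e = contradiction (sym e) (All.lookup x≢xs (∈-lookup i))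
  lookup-injective (_ ∷ xs!) (suc i) (suc j) e = cong suc (lookup-injective xs! i j e)

  Unique-++⁻ʳ : ∀ (xs : List A) {ys} → Unique (xs ++ ys) → Unique ys
  Unique-++⁻ʳ [] ys! = ys!
  Unique-++⁻ʳ (_ ∷ xs) (_ ∷ xs++ys!) = Unique-++⁻ʳ xs xs++ys!

  unique-⊆⇒∃↭++ : ∀ {xs ys : List A} → Unique ys → ys ⊆ xs → ∃ λ zs → xs ↭ ys ++ zs
  unique-⊆⇒∃↭++ {xs} {[]} _ _ = xs , ↭-refl
  unique-⊆⇒∃↭++ {_} {y ∷ ys} (y≢ys ∷ ys!) y∷ys⊆xs
    with us , vs , refl ← ∈-∃++ (y∷ys⊆xs (here refl)) =
      let zs , p = unique-⊆⇒∃↭++ ys! ys⊆us++vs in zs , ↭-trans (shift y us vs) (↭-prep y p)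
    where
    ys⊆us++vs : ys ⊆ us ++ vs
    ys⊆us++vs {x} x∈ys with ∈-resp-↭ (shift y us vs) (y∷ys⊆xs (there x∈ys))
    ... | here x≡y = contradiction (sym x≡y) (All.lookup y≢ys x∈ys)
    ... | there x∈us++vs = x∈us++vs

module FiniteType {A : Set} {n : ℕ} (enum : Fin n ↔ A) where

  open Inverse enum using (to; from; strictlyInverseˡ)

  to-injective : ∀ {i j} → to i ≡ to j → i ≡ j
  to-injective = Injection.injective (↔⇒↣ enum)

  _≟_ : (x y : A) → Dec (x ≡ y)
  _≟_ = via-injection (↔⇒↣ (↔-sym enum)) Fin._≟_

  open DecMembership _≟_ using (_∈?_)

  unique⇒length≤ : ∀ {xs : List A} → Unique xs → length xs ≤ n
  unique⇒length≤ {xs} xs! = Fin.injective⇒≤ {f = from ∘ lookup xs} injective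
    where
    injective : ∀ {i j} → from (lookup xs i) ≡ from (lookup xs j) → i ≡ j
    injective {i} {j} e = lookup-injective xs! i j (begin
      lookup xs i             ≡⟨ strictlyInverseˡ _ ⟨
      to (from (lookup xs i)) ≡⟨ cong to e ⟩
      to (from (lookup xs j)) ≡⟨ strictlyInverseˡ _ ⟩
      lookup xs j             ∎)
      where open ≡-Reasoning

  length<⇒∃∉ : ∀ {xs : List A} → length xs < n → ∃ λ x → x ∉ xs
  length<⇒∃∉ {xs} xs<n =
    let i , i∉ = Fin.¬∀⟶∃¬ n (λ i → to i ∈ xs) (λ i → to i ∈? xs) not-all in to i , i∉
    where
    not-all : ¬ (∀ i → to i ∈ xs)
    not-all all = <⇒≱ xs<n (Fin.injective⇒≤ {f = index ∘ all} index-injective)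
      where
      index-injective : ∀ {i j} → index (all i) ≡ index (all j) → i ≡ j
      index-injective {i} {j} e = to-injective (begin
        to i                      ≡⟨ lookup-index (all i) ⟩
        lookup xs (index (all i)) ≡⟨ cong (lookup xs) e ⟩
        lookup xs (index (all j)) ≡⟨ lookup-index (all j) ⟨
        to j                      ∎)
        where open ≡-Reasoning

  ∃-sole-non-member : ∀ {xs : List A} → Unique xs → suc (length xs) ≡ n →
                      ∃ λ a → ∀ x → x ≢ a → x ∈ xs
  ∃-sole-non-member {xs} xs! size = a , only-a
    where
    a∉xs : ∃ λ a → a ∉ xs
    a∉xs = length<⇒∃∉ (subst (length xs <_) size ≤-refl)
    a : A
    a = proj₁ a∉xs
    only-a : ∀ x → x ≢ a → x ∈ xs
    only-a x x≢a with x ∈? xs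
    ... | yes x∈xs = x∈xs
    ... | no x∉xs = contradiction (subst (_ ≤_) (sym size) (unique⇒length≤ a∷x∷xs!)) 1+n≰n
      where
      a∷x∷xs! : Unique (a ∷ x ∷ xs)
      a∷x∷xs! = (x≢a ∘ sym ∷ ¬Any⇒All¬ xs (proj₂ a∉xs)) ∷ ¬Any⇒All¬ xs x∉xs ∷ xs!

module FiniteAbelianGroup
  {A : Set} {_∙_ : Op₂ A} {ε : A} {_⁻¹ : Op₁ A}
  (isAbelianGroup : IsAbelianGroup _≡_ _∙_ ε _⁻¹)
  {n : ℕ} (enum : Fin n ↔ A)
  where

  open IsAbelianGroup isAbelianGroup using (_-_; comm; assoc; identityˡ; identityʳ; isCommutativeMonoid)

  abelianGroup : AbelianGroup _ _
  abelianGroup = record { isAbelianGroup = isAbelianGroup }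

  open AbelianGroupProperties abelianGroup
    using (//-rightDividesˡ; ∙-cancelˡ; x∙y⁻¹≈ε⇒x≈y; ⁻¹-anti-homo‿-)
  open FiniteType enum using (length<⇒∃∉; ∃-sole-non-member)

  -- Opened locally: ℕ's _+_ would clash with the field's _+_ in FiniteFieldProperties.
  open import Data.Nat using (_+_)
  open import Data.Nat.Properties
    using (+-identityʳ; +-suc; +-monoʳ-<; +-cancelʳ-<; m≤m+n; m≤n+m; m+n∸m≡n; m+n≤o⇒m≤o∸n; m∸n+n≡m)

  half-of-complement : ∀ {j k m} → suc (j + k) ≡ m → ¬ (k + k ≤ m) → j + j ≤ m
  half-of-complement {j} {k} refl k+k≰n = <⇒≤ (<-trans (+-monoʳ-< j j<k) (n<1+n (j + k)))
    where
    j<k : j < k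
    j<k = +-cancelʳ-< k j k (<-trans (n<1+n (j + k)) (≰⇒> k+k≰n))

  m<n∸o⇒o+m<n : ∀ {m} n o → m < n ∸ o → o + m < n
  m<n∸o⇒o+m<n (suc n) zero m<n = m<n
  m<n∸o⇒o+m<n (suc n) (suc o) m<n∸o = s≤s (m<n∸o⇒o+m<n n o m<n∸o)

  x∙[y-x]≡y : ∀ x y → x ∙ (y - x) ≡ y
  x∙[y-x]≡y x y = trans (comm x (y - x)) (//-rightDividesˡ x y)

  x-[x-y]≡y : ∀ x y → x - (x - y) ≡ y
  x-[x-y]≡y x y = trans (cong (x ∙_) (⁻¹-anti-homo‿- x y)) (x∙[y-x]≡y x y)

  sum : List A → A
  sum = foldr _∙_ ε

  sum-++ : ∀ xs ys → sum (xs ++ ys) ≡ sum xs ∙ sum ys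
  sum-++ [] ys = sym (identityˡ (sum ys))
  sum-++ (x ∷ xs) ys = trans (cong (x ∙_) (sum-++ xs ys)) (sym (assoc x (sum xs) (sum ys)))

  sum-↭ : ∀ {xs ys} → xs ↭ ys → sum xs ≡ sum ys
  sum-↭ p = PermutationSetoid.foldr-commMonoid (setoid A) isCommutativeMonoid (↭⇒↭ₛ p)

  HasAtMostOneHalf : A → Set
  HasAtMostOneHalf c = ∃ λ h → ∀ z → z ∙ z ≡ c → z ≡ h

  record DistinctSummandsIn (P : A → Set) (k : ℕ) (c : A) : Set where
    field
      summands : List A
      unique   : Unique summands
      length≡  : length summands ≡ k
      allIn    : All P summands
      sum≡     : sum summands ≡ c

  DistinctSummandsIn-map : ∀ {P Q : A → Set} {k c} → (∀ {x} → P x → Q x) →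
                           DistinctSummandsIn P k c → DistinctSummandsIn Q k c
  DistinctSummandsIn-map P⇒Q S = record
    { summands = summands
    ; unique   = unique
    ; length≡  = length≡
    ; allIn    = All.map P⇒Q allIn
    ; sum≡     = sum≡
    }
    where open DistinctSummandsIn S

  AdmissibleSize : ℕ → Set
  AdmissibleSize k = 2 ≤ k × (k ≡ 2 → ∀ c → HasAtMostOneHalf c)

  AdmissibleSize-mono : ∀ {d j} → d ≤ j → AdmissibleSize d → AdmissibleSize j
  AdmissibleSize-mono d≤j (2≤d , halves) =
    ≤-trans 2≤d d≤j , λ { refl → halves (≤-antisym d≤j 2≤d) }

  complementarySummands : ∀ {xs j b} → Unique xs → DistinctSummandsIn (_∈ xs) j (sum xs - b) →
               DistinctSummandsIn (_∈ xs) (length xs ∸ j) b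
  complementarySummands {xs} {j} {b} xs! S = record
    { summands = zs
    ; unique   = Unique-++⁻ʳ ys (PermutationSetoid.Unique-resp-↭ (setoid A) (↭⇒↭ₛ xs↭ys++zs) xs!)
    ; length≡  = sym (trans (cong (_∸ j) length-xs) (m+n∸m≡n j (length zs)))
    ; allIn    = All.tabulate (λ z∈zs → ∈-resp-↭ (↭-sym xs↭ys++zs) (∈-++⁺ʳ ys z∈zs))
    ; sum≡     = ∙-cancelˡ (sum xs - b) (sum zs) b (begin
        (sum xs - b) ∙ sum zs ≡⟨ cong (_∙ sum zs) sum≡ ⟨
        sum ys ∙ sum zs       ≡⟨ sum-++ ys zs ⟨
        sum (ys ++ zs)        ≡⟨ sum-↭ xs↭ys++zs ⟨
        sum xs                ≡⟨ //-rightDividesˡ b (sum xs) ⟨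
        (sum xs - b) ∙ b      ∎)
    }
    where
    open ≡-Reasoning
    open DistinctSummandsIn S renaming (summands to ys)
    split : ∃ λ zs → xs ↭ ys ++ zs
    split = unique-⊆⇒∃↭++ unique (All.lookup allIn)
    zs : List A
    zs = proj₁ split
    xs↭ys++zs : xs ↭ ys ++ zs
    xs↭ys++zs = proj₂ split
    length-xs : length xs ≡ j + length zs
    length-xs = trans (↭-length xs↭ys++zs) (trans (length-++ ys) (cong (_+ length zs) length≡))

  module _ (halves≢ε : ∀ c → c ≢ ε → HasAtMostOneHalf c) where

    -- y must avoid B, the half of c (so that y ≢ c - y) and c - B (so that c - y ∉ B).
    twoSummandsAvoiding : ∀ B c → HasAtMostOneHalf c → suc (length B + length B) < n →
           DistinctSummandsIn (_∉ B) 2 c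
    twoSummandsAvoiding B c (h , halves≡h) bound = build (length<⇒∃∉ room)
      where
      forbidden : List A
      forbidden = h ∷ B ++ map (c -_) B
      room : length forbidden < n
      room = subst (_< n) (cong suc (sym (trans (length-++ B) (cong (length B +_) (length-map (c -_) B))))) bound
      build : (∃ λ y → y ∉ forbidden) → DistinctSummandsIn (_∉ B) 2 c
      build (y , y∉) = record
        { summands = y ∷ c - y ∷ []
        ; unique   = (y≢c-y ∷ []) ∷ [] ∷ []
        ; length≡  = refl
        ; allIn    = y∉ ∘ there ∘ ∈-++⁺ˡ ∷ c-y∉B ∷ []
        ; sum≡     = trans (cong (y ∙_) (identityʳ (c - y))) (x∙[y-x]≡y y c)
        }
        where
        y≢c-y : y ≢ c - y
        y≢c-y e = y∉ (here (halves≡h y (trans (cong (y ∙_) e) (x∙[y-x]≡y y c))))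
        c-y∉B : c - y ∉ B
        c-y∉B c-y∈B =
          y∉ (there (∈-++⁺ʳ B (subst (_∈ map (c -_) B) (x-[x-y]≡y c y) (∈-map⁺ (c -_) c-y∈B))))

    -- The m extra summands enlarge B by m; the final pair then has to avoid 1 + 2 |B| points.
    summandsAvoiding : ∀ m B c → (m ≡ 0 → HasAtMostOneHalf c) →
                       suc ((length B + m) + (length B + m)) < n →
                       DistinctSummandsIn (_∉ B) (2 + m) c
    summandsAvoiding zero B c half bound =
      twoSummandsAvoiding B c (half refl) (subst (λ s → suc (s + s) < n) (+-identityʳ (length B)) bound)
    summandsAvoiding (suc m) B c _ bound = extend (length<⇒∃∉ room)
      where
      s : ℕ
      s = length B + suc m
      room : length (c ∷ B) < n
      room = ≤-trans (s≤s (s≤s (≤-trans (m≤m+n (length B) (suc m)) (m≤m+n s s)))) bound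
      extend : (∃ λ t → t ∉ c ∷ B) → DistinctSummandsIn (_∉ B) (3 + m) c
      extend (t , t∉) = record
        { summands = t ∷ summands
        ; unique   = All.map (λ x∉t∷B t≡x → x∉t∷B (here (sym t≡x))) allIn ∷ unique
        ; length≡  = cong suc length≡
        ; allIn    = t∉ ∘ there ∷ All.map (_∘ there) allIn
        ; sum≡     = trans (cong (t ∙_) sum≡) (x∙[y-x]≡y t c)
        }
        where
        c-t≢ε : c - t ≢ ε
        c-t≢ε e = t∉ (here (sym (x∙y⁻¹≈ε⇒x≈y c t e)))
        rest : DistinctSummandsIn (_∉ t ∷ B) (2 + m) (c - t)
        rest = summandsAvoiding m (t ∷ B) (c - t) (λ _ → halves≢ε (c - t) c-t≢ε)
                 (subst (λ s → suc (s + s) < n) (+-suc (length B) m) bound)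
        open DistinctSummandsIn rest

    module _ {xs : List A} (xs! : Unique xs) (size : suc (length xs) ≡ n) where

      private
        a : A
        a = proj₁ (∃-sole-non-member xs! size)
        ≢a⇒∈xs : ∀ x → x ≢ a → x ∈ xs
        ≢a⇒∈xs = proj₂ (∃-sole-non-member xs! size)

      distinctSummands-k+k≤n : ∀ {k} → AdmissibleSize k → k + k ≤ n →
                               ∀ c → DistinctSummandsIn (_∈ xs) k c
      distinctSummands-k+k≤n {suc (suc m)} (s≤s (s≤s z≤n) , half) k+k≤n c =
        DistinctSummandsIn-map (λ {x} x∉[a] → ≢a⇒∈xs x (x∉[a] ∘ here))
          (summandsAvoiding m [ a ] c (λ m≡0 → half (cong (2 +_) m≡0) c) bound)
        where
        bound : suc ((1 + m) + (1 + m)) < n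
        bound = subst (λ s → suc (suc s) ≤ n) (+-suc m (suc m)) k+k≤n

      -- d is a lower bound for the size of the complement, length xs ∸ k.
      distinctSummands : ∀ {d k} → AdmissibleSize d → AdmissibleSize k → k < n ∸ d →
                         ∀ b → DistinctSummandsIn (_∈ xs) k b
      distinctSummands {d} {k} d-admissible k-admissible k<n∸d b with k + k ≤? n
      ... | yes k+k≤n = distinctSummands-k+k≤n k-admissible k+k≤n b
      ... | no k+k≰n = subst (λ l → DistinctSummandsIn (_∈ xs) l b) (m∸[m∸n]≡n k≤L)
          (complementarySummands xs!
            (distinctSummands-k+k≤n (AdmissibleSize-mono d≤j d-admissible) j+j≤n (sum xs - b)))
        where
        L : ℕ
        L = length xs
        j : ℕ
        j = L ∸ k
        d+k≤L : d + k ≤ L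
        d+k≤L = s≤s⁻¹ (subst (d + k <_) (sym size) (m<n∸o⇒o+m<n n d k<n∸d))
        k≤L : k ≤ L
        k≤L = ≤-trans (m≤n+m k d) d+k≤L
        d≤j : d ≤ j
        d≤j = m+n≤o⇒m≤o∸n d d+k≤L
        j+j≤n : j + j ≤ n
        j+j≤n = half-of-complement {j} {k} (trans (cong suc (m∸n+n≡m k≤L)) size) k+k≰n

  2<⇒AdmissibleSize : ∀ {k} → 2 < k → AdmissibleSize k
  2<⇒AdmissibleSize 2<k = <⇒≤ 2<k , λ { refl → contradiction 2<k (n≮n 2) }

prime≢2⇒%2≡1 : ∀ {p} → Prime p → p ≢ 2 → p % 2 ≡ 1
prime≢2⇒%2≡1 {p} p-prime p≢2 with p % 2 in p%2≡ | m%n<n p 2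
... | 0 | _ with prime⇒irreducible p-prime (m%n≡0⇒n∣m p 2 p%2≡)
...   | inj₂ 2≡p = contradiction (sym 2≡p) p≢2
prime≢2⇒%2≡1 p-prime p≢2 | 1 | _ = refl
prime≢2⇒%2≡1 p-prime p≢2 | suc (suc _) | s≤s (s≤s ())

suc[m∸1]≡m : ∀ {m} → 0 < m ∸ 1 → suc (m ∸ 1) ≡ m
suc[m∸1]≡m {suc m} _ = refl

module FiniteFieldProperties (F : FiniteField) where

  open FiniteField F
  open IsCommutativeRing isCommutativeRing
    using (+-isAbelianGroup; +-assoc; +-identityˡ; +-identityʳ; *-identityʳ; *-assoc; distribˡ; zeroʳ)
  open FiniteAbelianGroup +-isAbelianGroup enum public
  open ≡-Reasoning

  x*[1+1]≡x+x : ∀ x → x * (1# + 1#) ≡ x + x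
  x*[1+1]≡x+x x = trans (distribˡ x 1# 1#) (cong₂ _+_ (*-identityʳ x) (*-identityʳ x))

  1+1≢0⇒halves : 1# + 1# ≢ 0# → ∀ c → HasAtMostOneHalf c
  1+1≢0⇒halves 1+1≢0 c = c * h , λ z z+z≡c → begin
    z                   ≡⟨ *-identityʳ z ⟨
    z * 1#              ≡⟨ cong (z *_) [1+1]h≡1 ⟨
    z * ((1# + 1#) * h) ≡⟨ *-assoc z (1# + 1#) h ⟨
    z * (1# + 1#) * h   ≡⟨ cong (_* h) (trans (x*[1+1]≡x+x z) z+z≡c) ⟩
    c * h               ∎
    where
    h : Carrier
    h = proj₁ (inverse (1# + 1#) 1+1≢0)
    [1+1]h≡1 : (1# + 1#) * h ≡ 1#
    [1+1]h≡1 = proj₂ (inverse (1# + 1#) 1+1≢0)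

  -- The witness is irrelevant: since z + z ≡ 0# for every z, a nonzero c has no half at all.
  1+1≡0⇒halves≢0 : 1# + 1# ≡ 0# → ∀ c → c ≢ 0# → HasAtMostOneHalf c
  1+1≡0⇒halves≢0 1+1≡0 c c≢0 = c , λ z z+z≡c → contradiction (begin
    c             ≡⟨ z+z≡c ⟨
    z + z         ≡⟨ x*[1+1]≡x+x z ⟨
    z * (1# + 1#) ≡⟨ cong (z *_) 1+1≡0 ⟩
    z * 0#        ≡⟨ zeroʳ z ⟩
    0#            ∎) c≢0

  1+1≡0⇒·1≡%2·1 : 1# + 1# ≡ 0# → ∀ n → n ·1 ≡ (n % 2) ·1
  1+1≡0⇒·1≡%2·1 1+1≡0 zero = refl
  1+1≡0⇒·1≡%2·1 1+1≡0 (suc zero) = refl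
  1+1≡0⇒·1≡%2·1 1+1≡0 (suc (suc n)) = begin
    1# + (1# + n ·1) ≡⟨ +-assoc 1# 1# (n ·1) ⟨
    (1# + 1#) + n ·1 ≡⟨ cong (_+ n ·1) 1+1≡0 ⟩
    0# + n ·1        ≡⟨ +-identityˡ (n ·1) ⟩
    n ·1             ≡⟨ 1+1≡0⇒·1≡%2·1 1+1≡0 n ⟩
    (n % 2) ·1       ∎

  characteristic≢2⇒1+1≢0 : ∀ {p} → HasCharacteristic F p → p ≢ 2 → 1# + 1# ≢ 0#
  characteristic≢2⇒1+1≢0 {p} (p-prime , p·1≡0) p≢2 1+1≡0 = 1≢0 (begin
    1#         ≡⟨ +-identityʳ 1# ⟨
    1 ·1       ≡⟨ cong _·1 (prime≢2⇒%2≡1 p-prime p≢2) ⟨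
    (p % 2) ·1 ≡⟨ 1+1≡0⇒·1≡%2·1 1+1≡0 p ⟨
    p ·1       ≡⟨ p·1≡0 ⟩
    0#         ∎)

  characteristic2⇒1+1≡0 : HasCharacteristic F 2 → 1# + 1# ≡ 0#
  characteristic2⇒1+1≡0 (_ , 2·1≡0) = trans (cong (1# +_) (sym (+-identityʳ 1#))) 2·1≡0

  sumFin-lookup : ∀ xs → sumFin (length xs) (lookup xs) ≡ sum xs
  sumFin-lookup [] = refl
  sumFin-lookup (x ∷ xs) = cong (x +_) (sumFin-lookup xs)

  DistinctSummandsIn⇒DistinctSumIn : ∀ {D k b} → DistinctSummandsIn (T ∘ D) k b → DistinctSumIn F D k b
  DistinctSummandsIn⇒DistinctSumIn {D} {b = b} S = subst (λ k → DistinctSumIn F D k b) length≡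
    (lookup summands , lookup-injective unique , All.lookup allIn ∘ ∈-lookup , trans (sumFin-lookup summands) sum≡)
    where open DistinctSummandsIn S

  module _ (D : Subset F) (card : HasCard F D (q ∸ 1)) where

    private
      members : List Carrier
      members = tabulate (proj₁ ∘ Inverse.to card)

      members-unique : Unique members
      members-unique = Unique.tabulate⁺ λ e → Injection.injective (↔⇒↣ card) (≡-on-proj₁ e)
        where
        ≡-on-proj₁ : ∀ {u v : Σ Carrier (T ∘ D)} → proj₁ u ≡ proj₁ v → u ≡ v
        ≡-on-proj₁ {x , px} {.x , py} refl = cong (x ,_) (T-irrelevant px py)

      member⇒∈D : ∀ {x} → x ∈ members → T (D x)
      member⇒∈D x∈members with i , refl ← ∈-tabulate⁻ x∈members = proj₂ (Inverse.to card i)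

    distinctSumIn : (∀ c → c ≢ 0# → HasAtMostOneHalf c) → suc (q ∸ 1) ≡ q →
                    ∀ {d k} → AdmissibleSize d → AdmissibleSize k → k < q ∸ d →
                    ∀ b → DistinctSumIn F D k b
    distinctSumIn halves≢0 size d-admissible k-admissible k<q∸d b =
      DistinctSummandsIn⇒DistinctSumIn (DistinctSummandsIn-map member⇒∈D
        (distinctSummands halves≢0 members-unique (trans (cong suc (length-tabulate _)) size)
          d-admissible k-admissible k<q∸d b))

corollary2p7 : (F : FiniteField) → (p : ℕ) → HasCharacteristic F p →
    (D : Subset F) → HasCard F D (FiniteField.q F ∸ 1) → 4 < FiniteField.q F ∸ 1 →
    ((¬ (p ≡ 2)) → (k : ℕ) → 1 < k → k < FiniteField.q F ∸ 2 →
      (b : FiniteField.Carrier F) → DistinctSumIn F D k b)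
    × ((p ≡ 2) → (k : ℕ) → 2 < k → k < FiniteField.q F ∸ 3 →
      (b : FiniteField.Carrier F) → DistinctSumIn F D k b)
corollary2p7 F p characteristic D card 4<q-1 = odd , even
  where
  open FiniteField F using (q)
  open FiniteFieldProperties F
  size : suc (q ∸ 1) ≡ q
  size = suc[m∸1]≡m (≤-trans (s≤s z≤n) 4<q-1)

  odd : p ≢ 2 → ∀ k → 1 < k → k < q ∸ 2 → ∀ b → DistinctSumIn F D k b
  odd p≢2 k 1<k = distinctSumIn D card (λ c _ → halves c) size (≤-refl , λ _ → halves) (1<k , λ _ → halves)
    where
    halves : ∀ c → HasAtMostOneHalf c
    halves = 1+1≢0⇒halves (characteristic≢2⇒1+1≢0 characteristic p≢2)

  even : p ≡ 2 → ∀ k → 2 < k → k < q ∸ 3 → ∀ b → DistinctSumIn F D k b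
  even refl k 2<k = distinctSumIn D card (1+1≡0⇒halves≢0 (characteristic2⇒1+1≡0 characteristic)) size
    (2<⇒AdmissibleSize ≤-refl) (2<⇒AdmissibleSize 2<k)
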